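{- The quasi-order $\trianglelefteq_{\mathsf{LO}}$ has chains of order type $(\mathbb{R},<)$, as well as antichains of size $2^{\aleph_0}$.
   Context: $\mathsf{LO}$ is the Polish space (closed subspace of $2^{\mathbb{N}\times\mathbb{N}}$) of codes $L$ for reflexive linear orders $\le_L$ on $\mathbb{N}$. For linear orders $L,L'$, $L\trianglelefteq L'$ (convex embeddability) iff there is an order embedding $f\colon L\to L'$ whose image $f(L)$ is a convex subset of $L'$ (i.e. $x\le_{L'} y\le_{L'} z$ with $x,z\in f(L)$ implies $y\in f(L)$). $\trianglelefteq_{\mathsf{LO}}$ denotes the restriction of $\trianglelefteq$ to $\mathsf{LO}$. A chain is a set of pairwise comparable elements in which distinct elements are not mutually related; an antichain is a set of pairwise incomparable elements. -}

module Defs where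

open import Data.Nat using (ℕ)
open import Data.Bool using (Bool; true; false)
open import Data.Product using (Σ; ∃; _×_; _,_)
open import Relation.Binary.PropositionalEquality using (_≡_)
open import Relation.Nullary using (¬_)
import Data.Rational as Q

-- Codes for linear orders on ℕ: elements of 2^(ℕ×ℕ) (curried) that
-- code a reflexive linear order  x ≤_L y  ⟺  L x y ≡ true.

Code : Set
Code = ℕ → ℕ → Bool

_⊢_≤_ : Code → ℕ → ℕ → Set
L ⊢ x ≤ y = L x y ≡ true

record IsLinearOrderCode (L : Code) : Set where
  field
    refl  : ∀ x → L ⊢ x ≤ x
    antisym : ∀ x y → L ⊢ x ≤ y → L ⊢ y ≤ x → x ≡ y
    trans : ∀ x y z → L ⊢ x ≤ y → L ⊢ y ≤ z → L ⊢ x ≤ z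
    total : ∀ x y → L x y ≡ false → L ⊢ y ≤ x

record LO : Set where
  constructor mkLO
  field
    code : Code
    isLO : IsLinearOrderCode code
open LO public

record ConvexEmbedding (L L' : Code) (f : ℕ → ℕ) : Set where
  field
    preserve : ∀ x y → L ⊢ x ≤ y → L' ⊢ f x ≤ f y
    reflect  : ∀ x y → L' ⊢ f x ≤ f y → L ⊢ x ≤ y
    convex   : ∀ x z y → L' ⊢ f x ≤ y → L' ⊢ y ≤ f z → ∃ λ w → f w ≡ y

_⊴_ : LO → LO → Set
L ⊴ L' = ∃ λ (f : ℕ → ℕ) → ConvexEmbedding (code L) (code L') f

-- The real line (ℝ,<), as (two-valued) Dedekind cuts of ℚ:
-- a real is its lower cut {q | q < r}.

record ℝ : Set where
  field
    cut       : Q.ℚ → Bool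
    inhabited : ∃ λ q → cut q ≡ true
    bounded   : ∃ λ q → cut q ≡ false
    downward  : ∀ p q → p Q.≤ q → cut q ≡ true → cut p ≡ true
    noMax     : ∀ q → cut q ≡ true → ∃ λ p → q Q.< p × cut p ≡ true
open ℝ public

_≃ℝ_ : ℝ → ℝ → Set
r ≃ℝ s = ∀ q → cut r q ≡ cut s q

_<ℝ_ : ℝ → ℝ → Set
r <ℝ s = ∃ λ q → cut r q ≡ false × cut s q ≡ true

-- Consider orders of the form ω·ω followed by finite blocks placed along a dense subset of ℚ
-- without maximum. Their blocks are exactly their maximal finite intervals, each with points on
-- both sides, and a convex embedding maps such an interval onto a maximal finite interval of the
-- same size; so L ⊴ L' forces every block size of L to occur in L'. For r ∈ ℝ, place a block of
-- size n + 1 at the rational coded by n, for every such rational below r: if r ≤ s the order for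
-- r is an initial segment of the order for s, while for r < s a rational between them gives a
-- block size of s missing from r. For a ∈ 2^ℕ, place a block at every rational, of a size that
-- records its code together with one bit of a; comparable orders then have equal bits.

module Submission where

open import Defs
open import Data.Bool as Bool using (Bool; true; false)
open import Data.Bool.Properties using (T-≡)
open import Data.Empty using (⊥; ⊥-elim)
open import Data.Integer using (ℤ; +_; -[1+_])
open import Data.Nat using (ℕ; zero; suc; _+_; _∸_; _≤_; _<_; _≤?_; z≤n; s≤s)
open import Data.Nat.Coprimality using (1-coprimeTo)
import Data.Nat.Properties as ℕ
open import Data.Product using (Σ; ∃; _×_; _,_; proj₁; proj₂; uncurry)
open import Data.Product.Relation.Binary.Lex.NonStrict using (×-Lex; ×-decTotalOrder)
open import Data.Product.Relation.Binary.Pointwise.NonDependent using (≡×≡⇒≡)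
open import Data.Rational as ℚ using (ℚ; mkℚ)
import Data.Rational.Properties as ℚ
open import Data.Sum using (_⊎_; inj₁; inj₂; [_,_]′; swap) renaming (map to ⊎-map)
open import Data.Unit using (⊤; tt)
open import Function using (flip; _∘_; id; const)
open import Function.Bundles using (Equivalence)
open import Level using (0ℓ)
open import Relation.Binary.Bundles using (DecTotalOrder)
open import Relation.Binary.Definitions using (tri<; tri≈; tri>)
open import Relation.Binary.PropositionalEquality
  using (_≡_; _≢_; refl; sym; trans; cong; subst; ≢-sym; module ≡-Reasoning)
open import Relation.Nullary using (¬_; Dec; does; yes; no; map′; _×-dec_; contradiction)
open import Relation.Nullary.Decidable using (dec-true; toWitness; isYes≗does)
open import Relation.Unary using (Pred; Decidable)

infix 4 _⊢_⋖_

record _⊢_⋖_ (L : Code) (x y : ℕ) : Set where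
  constructor covers
  field
    distinct : x ≢ y
    below    : L ⊢ x ≤ y
    between  : ∀ z → L ⊢ x ≤ z → L ⊢ z ≤ y → z ≡ x ⊎ z ≡ y

open _⊢_⋖_ using (distinct; below)

_⊢_⋖[_]_ : Code → ℕ → ℕ → ℕ → Set
L ⊢ x ⋖[ zero  ] y = x ≡ y
L ⊢ x ⋖[ suc t ] y = ∃ λ z → L ⊢ x ⋖ z × L ⊢ z ⋖[ t ] y

NoPredecessor : Code → ℕ → Set
NoPredecessor L x = ∀ w → ¬ L ⊢ w ⋖ x

NoSuccessor : Code → ℕ → Set
NoSuccessor L y = ∀ w → ¬ L ⊢ y ⋖ w

HasStrictlyBelow : Code → ℕ → Set
HasStrictlyBelow L x = ∃ λ b → b ≢ x × L ⊢ b ≤ x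

HasStrictlyAbove : Code → ℕ → Set
HasStrictlyAbove L y = HasStrictlyBelow (flip L) y

Block : Code → ℕ → ℕ → Set
Block L t x = NoPredecessor L x × ∃ λ y → L ⊢ x ⋖[ t ] y × NoSuccessor L y

InnerBlock : Code → ℕ → ℕ → Set
InnerBlock L t x =
  NoPredecessor L x × HasStrictlyBelow L x ×
  ∃ λ y → L ⊢ x ⋖[ t ] y × NoSuccessor L y × HasStrictlyAbove L y

≤-total : ∀ {L} → IsLinearOrderCode L → ∀ a b → L ⊢ a ≤ b ⊎ L ⊢ b ≤ a
≤-total {L} lo a b with L a b in eq
... | true  = inj₁ refl
... | false = inj₂ (IsLinearOrderCode.total lo a b eq)

⋖-unique : ∀ {L} → IsLinearOrderCode L → ∀ {x y y'} → L ⊢ x ⋖ y → L ⊢ x ⋖ y' → y ≡ y'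
⋖-unique lo {y = y} {y'} (covers x≢y x≤y between) (covers x≢y' x≤y' between') with ≤-total lo y y'
... | inj₁ y≤y' = [ (λ y≡x → contradiction (sym y≡x) x≢y) , id ]′ (between' y x≤y y≤y')
... | inj₂ y'≤y = [ (λ y'≡x → contradiction (sym y'≡x) x≢y') , sym ]′ (between y' x≤y' y'≤y)

⋖-nothing-between : ∀ {L x y z} → L ⊢ x ⋖ y → L ⊢ x ≤ z → L ⊢ z ≤ y → z ≢ x → z ≢ y →
                    ⊥
⋖-nothing-between x⋖y x≤z z≤y z≢x z≢y = [ z≢x , z≢y ]′ (_⊢_⋖_.between x⋖y _ x≤z z≤y)

⋖-flip : ∀ {L x y} → L ⊢ x ⋖ y → flip L ⊢ y ⋖ x
⋖-flip (covers x≢y x≤y between) =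
  covers (≢-sym x≢y) x≤y (λ z y≥z z≥x → swap (between z z≥x y≥z))

isLinearOrderCode-flip : ∀ {L} → IsLinearOrderCode L → IsLinearOrderCode (flip L)
isLinearOrderCode-flip lo = record
  { refl    = L.refl
  ; antisym = λ x y p q → L.antisym x y q p
  ; trans   = λ x y z p q → L.trans z y x q p
  ; total   = λ x y → L.total y x
  } where module L = IsLinearOrderCode lo

convexEmbedding-flip : ∀ {L L' f} → ConvexEmbedding L L' f → ConvexEmbedding (flip L) (flip L') f
convexEmbedding-flip E = record
  { preserve = λ x y → preserve y x
  ; reflect  = λ x y → reflect y x
  ; convex   = λ x z y p q → convex z x y q p
  } where open ConvexEmbedding E

module _ {L L' : Code} (lo : IsLinearOrderCode L) (lo' : IsLinearOrderCode L')
         {f : ℕ → ℕ} (E : ConvexEmbedding L L' f) where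

  open ConvexEmbedding E
  private
    module L  = IsLinearOrderCode lo
    module L' = IsLinearOrderCode lo'

  convexEmbedding-injective : ∀ {a b} → f a ≡ f b → a ≡ b
  convexEmbedding-injective {a} {b} fa≡fb =
    L.antisym a b (reflect a b (subst (L' ⊢ f a ≤_) fa≡fb (L'.refl (f a))))
                  (reflect b a (subst (L' ⊢_≤ f a) fa≡fb (L'.refl (f a))))

  -- A predecessor of f x lies between f b and f x, so by convexity it is the image of a predecessor of x.
  map-noPredecessor : ∀ {x} → HasStrictlyBelow L x → NoPredecessor L x → NoPredecessor L' (f x)
  map-noPredecessor {x} (b , b≢x , b≤x) noPred w (covers w≢fx w≤fx between) =
    noPred v (covers v≢x v≤x between-v)
    where
    fb≤w : L' ⊢ f b ≤ w
    fb≤w with ≤-total lo' (f b) w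
    ... | inj₁ fb≤w = fb≤w
    ... | inj₂ w≤fb with between (f b) w≤fb (preserve b x b≤x)
    ...   | inj₁ fb≡w = subst (L' ⊢ f b ≤_) fb≡w (L'.refl (f b))
    ...   | inj₂ fb≡fx = ⊥-elim (b≢x (convexEmbedding-injective fb≡fx))
    v : ℕ
    v = proj₁ (convex b x w fb≤w w≤fx)
    fv≡w : f v ≡ w
    fv≡w = proj₂ (convex b x w fb≤w w≤fx)
    v≢x : v ≢ x
    v≢x v≡x = w≢fx (trans (sym fv≡w) (cong f v≡x))
    v≤x : L ⊢ v ≤ x
    v≤x = reflect v x (subst (L' ⊢_≤ f x) (sym fv≡w) w≤fx)
    between-v : ∀ z → L ⊢ v ≤ z → L ⊢ z ≤ x → z ≡ v ⊎ z ≡ x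
    between-v z v≤z z≤x
      with between (f z) (subst (L' ⊢_≤ f z) fv≡w (preserve v z v≤z)) (preserve z x z≤x)
    ... | inj₁ fz≡w  = inj₁ (convexEmbedding-injective (trans fz≡w (sym fv≡w)))
    ... | inj₂ fz≡fx = inj₂ (convexEmbedding-injective fz≡fx)

module _ {L L' : Code} (lo : IsLinearOrderCode L) (lo' : IsLinearOrderCode L')
         {f : ℕ → ℕ} (E : ConvexEmbedding L L' f) where

  open ConvexEmbedding E

  map-⋖ : ∀ {a b} → L ⊢ a ⋖ b → L' ⊢ f a ⋖ f b
  map-⋖ {a} {b} (covers a≢b a≤b between) =
    covers (λ fa≡fb → a≢b (convexEmbedding-injective lo lo' E fa≡fb)) (preserve a b a≤b) between'
    where
    between' : ∀ z → L' ⊢ f a ≤ z → L' ⊢ z ≤ f b → z ≡ f a ⊎ z ≡ f b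
    between' z fa≤z z≤fb with convex a b z fa≤z z≤fb
    ... | w , refl with between w (reflect a w fa≤z) (reflect w b z≤fb)
    ...   | inj₁ w≡a = inj₁ (cong f w≡a)
    ...   | inj₂ w≡b = inj₂ (cong f w≡b)

  map-⋖[] : ∀ {x} t {y} → L ⊢ x ⋖[ t ] y → L' ⊢ f x ⋖[ t ] f y
  map-⋖[] zero    x≡y           = cong f x≡y
  map-⋖[] (suc t) (z , x⋖z , r) = f z , map-⋖ x⋖z , map-⋖[] t r

  map-noSuccessor : ∀ {y} → HasStrictlyAbove L y → NoSuccessor L y → NoSuccessor L' (f y)
  map-noSuccessor above noSucc w fy⋖w =
    map-noPredecessor (isLinearOrderCode-flip lo) (isLinearOrderCode-flip lo') (convexEmbedding-flip E)
      above (λ v v⋖y → noSucc v (⋖-flip v⋖y)) w (⋖-flip fy⋖w)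

  map-innerBlock : ∀ {t x} → InnerBlock L t x → Block L' t (f x)
  map-innerBlock {t} (noPred , below , y , x⋖y , noSucc , above) =
    map-noPredecessor lo lo' E below noPred , f y , map-⋖[] t x⋖y , map-noSuccessor above noSucc

-- Opaque, so that unification solves pair ?a ?b = pair a b instead of unfolding.
opaque
  triangle : ℕ → ℕ
  triangle zero    = zero
  triangle (suc s) = suc (s + triangle s)

  pair : ℕ → ℕ → ℕ
  pair a b = a + triangle (a + b)

  -- Enumerates ℕ × ℕ along the antidiagonals a + b = s, each from (0 , s) to (s , 0).
  unpair : ℕ → ℕ × ℕ
  unpair zero    = 0 , 0
  unpair (suc x) = next (unpair x)
    where
    next : ℕ × ℕ → ℕ × ℕ
    next (a , zero)  = zero , suc a
    next (a , suc b) = suc a , b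

  pair-unpair : ∀ x → uncurry pair (unpair x) ≡ x
  pair-unpair zero = refl
  pair-unpair (suc x) with unpair x | pair-unpair x
  ... | a , zero  | refl rewrite ℕ.+-identityʳ a = refl
  ... | a , suc b | refl rewrite ℕ.+-suc a b     = refl

  unpair-pair : ∀ a b → unpair (pair a b) ≡ (a , b)
  unpair-pair a b = go (a + b) a b refl
    where
    go : ∀ s a b → a + b ≡ s → unpair (a + triangle s) ≡ (a , b)
    go zero    zero    .zero    refl = refl
    go (suc s) zero    .(suc s) refl rewrite go s s 0 (ℕ.+-identityʳ s) = refl
    go s       (suc a) b        eq   rewrite go s a (suc b) (trans (ℕ.+-suc a b) eq) = refl

pair-injective : ∀ {a b c d} → pair a b ≡ pair c d → a ≡ c × b ≡ d
pair-injective {a} {b} {c} {d} eq = cong proj₁ ab≡cd , cong proj₂ ab≡cd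
  where
  ab≡cd : (a , b) ≡ (c , d)
  ab≡cd = trans (sym (unpair-pair a b)) (trans (cong unpair eq) (unpair-pair c d))

infix 4 _≤ₗₑₓ_ _≤K_ _≤K?_

private
  module Lex = DecTotalOrder (×-decTotalOrder ℕ.≤-decTotalOrder ℕ.≤-decTotalOrder)

_≤ₗₑₓ_ : ℕ × ℕ → ℕ × ℕ → Set
_≤ₗₑₓ_ = ×-Lex _≡_ _≤_ _≤_

-- filler n i is the i-th point of the n-th copy of ω, block p n i the i-th point of the block at p.
data Key : Set where
  filler : ℕ → ℕ → Key
  block  : ℚ → ℕ → ℕ → Key

-- An ω·ω of filler points, followed by the blocks in the order of ℚ.
data _≤K_ : Key → Key → Set where
  filler≤filler : ∀ {n i m j} → (n , i) ≤ₗₑₓ (m , j) → filler n i ≤K filler m j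
  filler≤block  : ∀ {n i p m j} → filler n i ≤K block p m j
  block<block   : ∀ {p p' n i m j} → p ℚ.< p' → block p n i ≤K block p' m j
  block≤block   : ∀ {p n i m j} → (n , i) ≤ₗₑₓ (m , j) → block p n i ≤K block p m j

≤K-refl : ∀ a → a ≤K a
≤K-refl (filler n i)  = filler≤filler Lex.refl
≤K-refl (block p n i) = block≤block Lex.refl

≤K-antisym : ∀ {a b} → a ≤K b → b ≤K a → a ≡ b
≤K-antisym (filler≤filler x) (filler≤filler y) = cong (uncurry filler) (≡×≡⇒≡ (Lex.antisym x y))
≤K-antisym (block<block x)   (block<block y)   = ⊥-elim (ℚ.<-asym x y)
≤K-antisym (block<block x)   (block≤block _)   = ⊥-elim (ℚ.<-irrefl refl x)
≤K-antisym (block≤block _)   (block<block y)   = ⊥-elim (ℚ.<-irrefl refl y)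
≤K-antisym (block≤block x)   (block≤block y)   = cong (uncurry (block _)) (≡×≡⇒≡ (Lex.antisym x y))

≤K-trans : ∀ {a b c} → a ≤K b → b ≤K c → a ≤K c
≤K-trans (filler≤filler x) (filler≤filler y) = filler≤filler (Lex.trans x y)
≤K-trans (filler≤filler _) filler≤block      = filler≤block
≤K-trans filler≤block      (block<block _)   = filler≤block
≤K-trans filler≤block      (block≤block _)   = filler≤block
≤K-trans (block<block x)   (block<block y)   = block<block (ℚ.<-trans x y)
≤K-trans (block<block x)   (block≤block _)   = block<block x
≤K-trans (block≤block _)   (block<block y)   = block<block y
≤K-trans (block≤block x)   (block≤block y)   = block≤block (Lex.trans x y)

≤K-total : ∀ a b → a ≤K b ⊎ b ≤K a
≤K-total (filler n i)  (filler m j)   = ⊎-map filler≤filler filler≤filler (Lex.total (n , i) (m , j))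
≤K-total (filler _ _)  (block _ _ _)  = inj₁ filler≤block
≤K-total (block _ _ _) (filler _ _)   = inj₂ filler≤block
≤K-total (block p n i) (block p' m j) with ℚ.<-cmp p p'
... | tri< p<p' _ _ = inj₁ (block<block p<p')
... | tri> _ _ p'<p = inj₂ (block<block p'<p)
... | tri≈ _ refl _ = ⊎-map block≤block block≤block (Lex.total (n , i) (m , j))

_≤K?_ : ∀ a b → Dec (a ≤K b)
filler n i  ≤K? filler m j   =
  map′ filler≤filler (λ { (filler≤filler x) → x }) ((n , i) Lex.≤? (m , j))
filler _ _  ≤K? block _ _ _  = yes filler≤block
block _ _ _ ≤K? filler _ _   = no λ ()
block p n i ≤K? block p' m j with ℚ.<-cmp p p'
... | tri< p<p' _ _ = yes (block<block p<p')
... | tri> p≮p' _ p'<p =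
  no λ { (block<block p<p') → p≮p' p<p' ; (block≤block _) → ℚ.<-irrefl refl p'<p }
... | tri≈ p≮p refl _ =
  map′ block≤block (λ { (block<block p<p) → ⊥-elim (p≮p p<p) ; (block≤block x) → x })
       ((n , i) Lex.≤? (m , j))

lex-between : ∀ {n i} c → (n , i) ≤ₗₑₓ c → c ≤ₗₑₓ (n , suc i) →
              c ≡ (n , i) ⊎ c ≡ (n , suc i)
lex-between _ (inj₁ (n≤m , n≢m)) (inj₁ (m≤n , _))  = contradiction (ℕ.≤-antisym n≤m m≤n) n≢m
lex-between _ (inj₁ (_ , n≢m))   (inj₂ (m≡n , _))  = contradiction (sym m≡n) n≢m
lex-between _ (inj₂ (refl , _))  (inj₁ (_ , n≢n))  = contradiction refl n≢n
lex-between _ (inj₂ (refl , i≤j)) (inj₂ (_ , j≤1+i)) with ℕ.m≤n⇒m<n∨m≡n i≤j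
... | inj₁ i<j  = inj₂ (cong (_ ,_) (ℕ.≤-antisym j≤1+i i<j))
... | inj₂ refl = inj₁ refl

block-≢ : ∀ {p p' n i m j} → p ℚ.< p' → block p n i ≢ block p' m j
block-≢ p<p' refl = ℚ.<-irrefl refl p<p'

block≤block⁻¹ : ∀ {p p' n i m j} → block p n i ≤K block p' m j →
                p ℚ.< p' ⊎ (p ≡ p' × (n , i) ≤ₗₑₓ (m , j))
block≤block⁻¹ (block<block p<p') = inj₁ p<p'
block≤block⁻¹ (block≤block x)    = inj₂ (refl , x)

block≤block⇒≤ : ∀ {p p' n i m j} → block p n i ≤K block p' m j → p ℚ.≤ p'
block≤block⇒≤ (block<block p<p') = ℚ.<⇒≤ p<p'
block≤block⇒≤ (block≤block _)    = ℚ.≤-refl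

Consecutive : Key → Key → Set
Consecutive a b = a ≢ b × a ≤K b × ∀ c → a ≤K c → c ≤K b → c ≡ a ⊎ c ≡ b

filler-consecutive : ∀ n i → Consecutive (filler n i) (filler n (suc i))
filler-consecutive n i = (λ ()) , filler≤filler (inj₂ (refl , ℕ.n≤1+n i)) , between
  where
  between : ∀ c → filler n i ≤K c → c ≤K filler n (suc i) →
            c ≡ filler n i ⊎ c ≡ filler n (suc i)
  between (filler m j) (filler≤filler x) (filler≤filler y) =
    ⊎-map (cong (uncurry filler)) (cong (uncurry filler)) (lex-between (m , j) x y)

block-consecutive : ∀ p n i → Consecutive (block p n i) (block p n (suc i))
block-consecutive p n i = (λ ()) , block≤block (inj₂ (refl , ℕ.n≤1+n i)) , between
  where
  between : ∀ c → block p n i ≤K c → c ≤K block p n (suc i) →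
            c ≡ block p n i ⊎ c ≡ block p n (suc i)
  between (block p' m j) (block<block x) (block<block y) = ⊥-elim (ℚ.<-asym x y)
  between (block p' m j) (block<block x) (block≤block _) = ⊥-elim (ℚ.<-irrefl refl x)
  between (block p' m j) (block≤block _) (block<block y) = ⊥-elim (ℚ.<-irrefl refl y)
  between (block p' m j) (block≤block x) (block≤block y) =
    ⊎-map (cong (uncurry (block p))) (cong (uncurry (block p))) (lex-between (m , j) x y)

record DenseWithoutMaximum (P : Pred ℕ 0ℓ) (q : ℕ → ℚ) : Set where
  field
    injective : ∀ {m n} → P m → P n → q m ≡ q n → m ≡ n
    dense     : ∀ {m n} → P m → P n → q m ℚ.< q n →
                ∃ λ n' → P n' × q m ℚ.< q n' × q n' ℚ.< q n
    unbounded : ∀ {n} → P n → ∃ λ n' → P n' × q n ℚ.< q n'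

-- The order ω·ω + Σ_{n ∈ P, ordered by q n} (k n + 1): the points pair n i with n ∈ P and
-- i ≤ k n form the block placed at q n, all other points fill the initial ω·ω.
module BlockSum {P : Pred ℕ 0ℓ} (P? : Decidable P) (k : ℕ → ℕ) (q : ℕ → ℚ) where

  record InBlock (n i : ℕ) : Set where
    constructor inBlock
    field
      member  : P n
      bounded : i ≤ k n

  inBlock? : ∀ n i → Dec (InBlock n i)
  inBlock? n i = map′ (uncurry inBlock) (λ (inBlock Pn i≤kn) → Pn , i≤kn) (P? n ×-dec (i ≤? k n))

  keyFor : ∀ {n i} → Dec (InBlock n i) → Key
  keyFor {n} {i} (yes _) = block (q n) n i
  keyFor {n} {i} (no  _) = filler n i

  opaque
    key : ℕ → Key
    key x = uncurry (λ n i → keyFor (inBlock? n i)) (unpair x)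

    key-pair : ∀ n i → key (pair n i) ≡ keyFor (inBlock? n i)
    key-pair n i = cong (uncurry (λ n i → keyFor (inBlock? n i))) (unpair-pair n i)

  key-block : ∀ {n i} → InBlock n i → key (pair n i) ≡ block (q n) n i
  key-block {n} {i} b = trans (key-pair n i) (keyFor-yes (inBlock? n i))
    where
    keyFor-yes : (d : Dec (InBlock n i)) → keyFor d ≡ block (q n) n i
    keyFor-yes (yes _) = refl
    keyFor-yes (no ¬b) = contradiction b ¬b

  key-filler : ∀ {n i} → ¬ InBlock n i → key (pair n i) ≡ filler n i
  key-filler {n} {i} ¬b = trans (key-pair n i) (keyFor-no (inBlock? n i))
    where
    keyFor-no : (d : Dec (InBlock n i)) → keyFor d ≡ filler n i
    keyFor-no (yes b) = contradiction b ¬b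
    keyFor-no (no  _) = refl

  data PointView : ℕ → Set where
    isBlock  : ∀ {n i} → InBlock n i → PointView (pair n i)
    isFiller : ∀ {n i} → ¬ InBlock n i → PointView (pair n i)

  pointView : ∀ x → PointView x
  pointView x with unpair x | pair-unpair x
  ... | n , i | refl with inBlock? n i
  ...   | yes b = isBlock b
  ...   | no ¬b = isFiller ¬b

  open InBlock public

  blockStart : ∀ {n} → P n → InBlock n 0
  blockStart Pn = inBlock Pn z≤n

  blockEnd : ∀ {n} → P n → InBlock n (k n)
  blockEnd Pn = inBlock Pn ℕ.≤-refl

  inBlock-≤ : ∀ {n i j} → i ≤ j → InBlock n j → InBlock n i
  inBlock-≤ i≤j (inBlock Pn j≤kn) = inBlock Pn (ℕ.≤-trans i≤j j≤kn)

  orderCode : Code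
  orderCode x y = does (key x ≤K? key y)

  ≤K⇒≤ : ∀ {x y} → key x ≤K key y → orderCode ⊢ x ≤ y
  ≤K⇒≤ = dec-true (_ ≤K? _)

  ≤⇒≤K : ∀ {x y} → orderCode ⊢ x ≤ y → key x ≤K key y
  ≤⇒≤K {x} {y} x≤y = toWitness (Equivalence.from T-≡ (trans (isYes≗does (key x ≤K? key y)) x≤y))

  position : Key → ℕ × ℕ
  position (filler n i)  = n , i
  position (block _ n i) = n , i

  pair-position : ∀ x → uncurry pair (position (key x)) ≡ x
  pair-position x with pointView x
  ... | isBlock  b  rewrite key-block b   = refl
  ... | isFiller ¬b rewrite key-filler ¬b = refl

  key-injective : ∀ {x y} → key x ≡ key y → x ≡ y
  key-injective {x} {y} eq =
    trans (sym (pair-position x)) (trans (cong (uncurry pair ∘ position) eq) (pair-position y))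

  isLinearOrderCode : IsLinearOrderCode orderCode
  isLinearOrderCode = record
    { refl    = λ x → ≤K⇒≤ (≤K-refl (key x))
    ; antisym = λ x y p q → key-injective (≤K-antisym (≤⇒≤K p) (≤⇒≤K q))
    ; trans   = λ x y z p q → ≤K⇒≤ (≤K-trans (≤⇒≤K p) (≤⇒≤K q))
    ; total   = λ x y x≰y → [ (λ x≤y → contradiction (trans (sym (≤K⇒≤ x≤y)) x≰y) λ ()) , ≤K⇒≤ ]′
                                (≤K-total (key x) (key y))
    }

  lo : LO
  lo = mkLO orderCode isLinearOrderCode

  ≤-byKeys : ∀ {x y a b} → key x ≡ a → key y ≡ b → a ≤K b → orderCode ⊢ x ≤ y
  ≤-byKeys refl refl = ≤K⇒≤

  ≤⇒≤-keys : ∀ {x y a b} → key x ≡ a → key y ≡ b → orderCode ⊢ x ≤ y → a ≤K b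
  ≤⇒≤-keys refl refl = ≤⇒≤K

  ≢-byKeys : ∀ {x y a b} → key x ≡ a → key y ≡ b → a ≢ b → x ≢ y
  ≢-byKeys refl refl a≢b refl = a≢b refl

  ⋖-byKeys : ∀ {x y a b} → key x ≡ a → key y ≡ b → Consecutive a b → orderCode ⊢ x ⋖ y
  ⋖-byKeys refl refl (a≢b , a≤b , between) =
    covers (≢-byKeys refl refl a≢b) (≤K⇒≤ a≤b)
      λ z x≤z z≤y → ⊎-map key-injective key-injective (between (key z) (≤⇒≤K x≤z) (≤⇒≤K z≤y))

  ⋖-noKeyBetween : ∀ {x y z a b c} → orderCode ⊢ x ⋖ y →
                   key x ≡ a → key z ≡ c → key y ≡ b → a ≤K c → c ≤K b → c ≢ a → c ≢ b → ⊥
  ⋖-noKeyBetween x⋖y refl refl refl a≤c c≤b c≢a c≢b =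
    ⋖-nothing-between x⋖y (≤K⇒≤ a≤c) (≤K⇒≤ c≤b)
      (≢-byKeys refl refl c≢a) (≢-byKeys refl refl c≢b)

  ⋖-inBlock : ∀ {n i} → InBlock n (suc i) → orderCode ⊢ pair n i ⋖ pair n (suc i)
  ⋖-inBlock b = ⋖-byKeys (key-block (inBlock-≤ (ℕ.n≤1+n _) b)) (key-block b) (block-consecutive _ _ _)

  ⋖-filler : ∀ {n i} → ¬ InBlock n i → orderCode ⊢ pair n i ⋖ pair n (suc i)
  ⋖-filler ¬b =
    ⋖-byKeys (key-filler ¬b) (key-filler (¬b ∘ inBlock-≤ (ℕ.n≤1+n _))) (filler-consecutive _ _)

  ⋖[]-inBlock : ∀ {n} t j → InBlock n (j + t) → orderCode ⊢ pair n j ⋖[ t ] pair n (j + t)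
  ⋖[]-inBlock zero    j b rewrite ℕ.+-identityʳ j = refl
  ⋖[]-inBlock (suc t) j b rewrite ℕ.+-suc j t =
    pair _ (suc j) , ⋖-inBlock (inBlock-≤ (s≤s (ℕ.m≤m+n j t)) b) , ⋖[]-inBlock t (suc j) b

  module _ (D : DenseWithoutMaximum P q) where

    open DenseWithoutMaximum D

    ¬⋖-acrossBlocks : ∀ {a i n j} → InBlock a i → InBlock n j → q a ℚ.< q n →
                      ¬ orderCode ⊢ pair a i ⋖ pair n j
    ¬⋖-acrossBlocks ai nj qa<qn ai⋖nj with dense (member ai) (member nj) qa<qn
    ... | n' , Pn' , qa<qn' , qn'<qn =
      ⋖-noKeyBetween ai⋖nj (key-block ai) (key-block (blockStart Pn')) (key-block nj)
        (block<block qa<qn') (block<block qn'<qn)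
        (≢-sym (block-≢ qa<qn')) (block-≢ qn'<qn)

    noPredecessor-blockStart : ∀ {n} → P n → NoPredecessor orderCode (pair n 0)
    noPredecessor-blockStart Pn w w⋖x with pointView w
    ... | isFiller {a} {i} ¬ai =
      ⋖-noKeyBetween w⋖x (key-filler ¬ai) (key-filler (¬ai ∘ inBlock-≤ (ℕ.n≤1+n i)))
        (key-block (blockStart Pn)) (filler≤filler (inj₂ (refl , ℕ.n≤1+n i))) filler≤block (λ ()) (λ ())
    ... | isBlock ai
      with block≤block⁻¹ (≤⇒≤-keys (key-block ai) (key-block (blockStart Pn)) (below w⋖x))
    ...   | inj₁ qa<qn = ¬⋖-acrossBlocks ai (blockStart Pn) qa<qn w⋖x
    ...   | inj₂ (qa≡qn , inj₁ (_ , a≢n)) = a≢n (injective (member ai) Pn qa≡qn)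
    ...   | inj₂ (_ , inj₂ (refl , i≤0)) rewrite ℕ.n≤0⇒n≡0 i≤0 = distinct w⋖x refl

    noSuccessor-blockEnd : ∀ {n} → P n → NoSuccessor orderCode (pair n (k n))
    noSuccessor-blockEnd Pn w x⋖w with pointView w
    ... | isFiller ¬ai with ≤⇒≤-keys (key-block (blockEnd Pn)) (key-filler ¬ai) (below x⋖w)
    ...   | ()
    noSuccessor-blockEnd Pn w x⋖w | isBlock ai
      with block≤block⁻¹ (≤⇒≤-keys (key-block (blockEnd Pn)) (key-block ai) (below x⋖w))
    ... | inj₁ qn<qa = ¬⋖-acrossBlocks (blockEnd Pn) ai qn<qa x⋖w
    ... | inj₂ (qn≡qa , inj₁ (_ , n≢a)) = n≢a (injective Pn (member ai) qn≡qa)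
    ... | inj₂ (_ , inj₂ (refl , kn≤i)) rewrite ℕ.≤-antisym (bounded ai) kn≤i = distinct x⋖w refl

    ⋖-step : ∀ {a i z} → orderCode ⊢ pair a i ⋖ z →
             z ≡ pair a (suc i) × (InBlock a i → InBlock a (suc i))
    ⋖-step {a} {i} x⋖z with inBlock? a (suc i) | inBlock? a i
    ... | yes b' | _      = ⋖-unique isLinearOrderCode x⋖z (⋖-inBlock b') , const b'
    ... | no ¬b' | no ¬b  = ⋖-unique isLinearOrderCode x⋖z (⋖-filler ¬b) , (λ b → contradiction b ¬b)
    ... | no ¬b' | yes (inBlock Pa i≤ka) with ℕ.m≤n⇒m<n∨m≡n i≤ka
    ...   | inj₁ i<ka = contradiction (inBlock Pa i<ka) ¬b'
    ...   | inj₂ refl = ⊥-elim (noSuccessor-blockEnd Pa _ x⋖z)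

    ⋖[]-row : ∀ {a} t {i y} → orderCode ⊢ pair a i ⋖[ t ] y →
              y ≡ pair a (i + t) × (InBlock a i → InBlock a (i + t))
    ⋖[]-row zero {i} refl rewrite ℕ.+-identityʳ i = refl , id
    ⋖[]-row (suc t) {i} (z , x⋖z , z⋖y) with ⋖-step x⋖z
    ... | refl , grow with ⋖[]-row t z⋖y
    ...   | y≡ , grow' rewrite ℕ.+-suc i t = y≡ , grow' ∘ grow

    innerBlock : ∀ {n} → P n → InnerBlock orderCode (k n) (pair n 0)
    innerBlock {n} Pn =
      noPredecessor-blockStart Pn , strictlyBelow ,
      pair n (k n) , ⋖[]-inBlock (k n) 0 (blockEnd Pn) , noSuccessor-blockEnd Pn , strictlyAbove
      where
      strictlyBelow : HasStrictlyBelow orderCode (pair n 0)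
      strictlyBelow = pair 0 (suc (k 0)) , ≢-byKeys kf (key-block (blockStart Pn)) (λ ()) ,
                                           ≤-byKeys kf (key-block (blockStart Pn)) filler≤block
        where kf = key-filler (ℕ.1+n≰n ∘ bounded)
      strictlyAbove : HasStrictlyAbove orderCode (pair n (k n))
      strictlyAbove with unbounded Pn
      ... | n' , Pn' , qn<qn' =
        pair n' 0 , ≢-byKeys kn' (key-block (blockEnd Pn)) (≢-sym (block-≢ qn<qn')) ,
                    ≤-byKeys (key-block (blockEnd Pn)) kn' (block<block qn<qn')
        where kn' = key-block (blockStart Pn')

    block⇒width : ∀ {t x} → Block orderCode t x → ∃ λ n → P n × t ≡ k n
    block⇒width {t} {x} (noPred , y , x⋖y , noSucc) with pointView x
    ... | isFiller {a} {i} ¬b with ⋖[]-row t x⋖y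
    ...   | refl , _ = ⊥-elim (noSucc _ (⋖-filler (¬b ∘ inBlock-≤ (ℕ.m≤m+n i t))))
    block⇒width (noPred , _) | isBlock {a} {suc i} b = ⊥-elim (noPred _ (⋖-inBlock b))
    block⇒width {t} (_ , y , x⋖y , noSucc) | isBlock {a} {zero} b with ⋖[]-row t x⋖y
    ... | refl , grow with ℕ.m≤n⇒m<n∨m≡n (bounded (grow b))
    ...   | inj₂ t≡ka = a , member b , t≡ka
    ...   | inj₁ t<ka = ⊥-elim (noSucc _ (⋖-inBlock (inBlock (member b) t<ka)))

module _ {P P' : Pred ℕ 0ℓ} (P? : Decidable P) (P'? : Decidable P') (k : ℕ → ℕ) (q : ℕ → ℚ)
         (P⊆P' : ∀ {n} → P n → P' n)
         (P-downward : ∀ {m n} → P' m → P n → q m ℚ.≤ q n → P m) where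

  private
    module S  = BlockSum P? k q
    module S' = BlockSum P'? k q

  shiftFor : ∀ {n} → Dec (P n) → Dec (P' n) → ℕ
  shiftFor {n} (no _) (yes _) = suc (k n)
  shiftFor        _      _    = 0

  -- In S' the rows of indices in P' ∖ P start with their blocks; the embedding skips them.
  shift : ℕ → ℕ
  shift n = shiftFor (P? n) (P'? n)

  shift-old : ∀ {n} → (P' n → P n) → shift n ≡ 0
  shift-old {n} P'n⇒Pn = go (P? n) (P'? n)
    where
    go : (d : Dec (P n)) (d' : Dec (P' n)) → shiftFor d d' ≡ 0
    go (yes _)  _        = refl
    go (no ¬Pn) (yes P'n) = contradiction (P'n⇒Pn P'n) ¬Pn
    go (no _)   (no _)   = refl

  shift-new : ∀ {n} → ¬ P n → P' n → shift n ≡ suc (k n)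
  shift-new {n} ¬Pn P'n = go (P? n) (P'? n)
    where
    go : (d : Dec (P n)) (d' : Dec (P' n)) → shiftFor d d' ≡ suc (k n)
    go (yes Pn) _         = contradiction Pn ¬Pn
    go (no _)   (yes _)   = refl
    go (no _)   (no ¬P'n) = contradiction P'n ¬P'n

  embed : ℕ → ℕ
  embed x = uncurry (λ n i → pair n (i + shift n)) (unpair x)

  embed-pair : ∀ n i → embed (pair n i) ≡ pair n (i + shift n)
  embed-pair n i = cong (uncurry (λ n i → pair n (i + shift n))) (unpair-pair n i)

  embed-unshifted : ∀ {m j} → shift m ≡ 0 → embed (pair m j) ≡ pair m j
  embed-unshifted {m} {j} s≡0 =
    trans (embed-pair m j) (cong (pair m) (trans (cong (λ s → j + s) s≡0) (ℕ.+-identityʳ j)))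

  shiftKey : Key → Key
  shiftKey (filler n i)  = filler n (i + shift n)
  shiftKey (block p n i) = block p n i

  shiftKey-mono : ∀ {a b} → a ≤K b → shiftKey a ≤K shiftKey b
  shiftKey-mono (filler≤filler (inj₁ n<m))        = filler≤filler (inj₁ n<m)
  shiftKey-mono (filler≤filler (inj₂ (refl , i≤j))) = filler≤filler (inj₂ (refl , ℕ.+-monoˡ-≤ _ i≤j))
  shiftKey-mono filler≤block                      = filler≤block
  shiftKey-mono (block<block p<p')                = block<block p<p'
  shiftKey-mono (block≤block x)                   = block≤block x

  shiftKey-reflect : ∀ {a b} → shiftKey a ≤K shiftKey b → a ≤K b
  shiftKey-reflect {filler _ _}   {filler _ _}   (filler≤filler (inj₁ n<m)) = filler≤filler (inj₁ n<m)
  shiftKey-reflect {filler n i}   {filler _ j}   (filler≤filler (inj₂ (refl , le))) =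
    filler≤filler (inj₂ (refl , ℕ.+-cancelʳ-≤ (shift n) i j le))
  shiftKey-reflect {filler _ _}   {block _ _ _}  filler≤block       = filler≤block
  shiftKey-reflect {block _ _ _}  {block _ _ _}  (block<block p<p') = block<block p<p'
  shiftKey-reflect {block _ _ _}  {block _ _ _}  (block≤block x)    = block≤block x

  notInBlock-shift : ∀ {n i} → ¬ S.InBlock n i → ¬ S'.InBlock n (i + shift n)
  notInBlock-shift {n} {i} ¬b (S'.inBlock P'n i+s≤kn) with P? n | P'? n
  ... | yes Pn  | _      = ¬b (S.inBlock Pn (ℕ.≤-trans (ℕ.m≤m+n i _) i+s≤kn))
  ... | no _    | yes _  = ℕ.1+n≰n (ℕ.≤-trans (ℕ.m≤n+m (suc (k n)) i) i+s≤kn)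
  ... | no _    | no ¬P'n = ¬P'n P'n

  key-embed : ∀ x → S'.key (embed x) ≡ shiftKey (S.key x)
  key-embed x with S.pointView x
  ... | S.isBlock {n} {i} b
    rewrite embed-pair n i | shift-old {n} (λ _ → S.member b) | ℕ.+-identityʳ i | S.key-block b
    = S'.key-block (S'.inBlock (P⊆P' (S.member b)) (S.bounded b))
  ... | S.isFiller {n} {i} ¬b rewrite embed-pair n i | S.key-filler ¬b =
    S'.key-filler (notInBlock-shift ¬b)

  -- The image of embed is an initial segment: it misses only the blocks of P' ∖ P, which lie above it.
  newBlock-aboveImage : ∀ {m j} → S'.InBlock m j → ¬ P m →
                        ∀ z → ¬ S'.orderCode ⊢ pair m j ≤ embed z
  newBlock-aboveImage {m} {j} b' ¬Pm z y≤ez with S.pointView z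
  ... | S.isFiller {n} {i} ¬b
    with S'.≤⇒≤-keys (S'.key-block b') (trans (key-embed _) (cong shiftKey (S.key-filler ¬b))) y≤ez
  ...   | ()
  newBlock-aboveImage {m} {j} b' ¬Pm z y≤ez | S.isBlock {n} {i} b =
    ¬Pm (P-downward (S'.member b') (S.member b) (block≤block⇒≤ key≤))
    where
    key≤ : block (q m) m j ≤K block (q n) n i
    key≤ = S'.≤⇒≤-keys (S'.key-block b') (trans (key-embed _) (cong shiftKey (S.key-block b))) y≤ez

  embed-surjective : ∀ m j → ¬ (S'.InBlock m j × ¬ P m) → ∃ λ w → embed w ≡ pair m j
  embed-surjective m j notNew with P? m | P'? m
  ... | yes Pm | _       = pair m j , embed-unshifted (shift-old (const Pm))
  ... | no _   | no ¬P'm = pair m j , embed-unshifted (shift-old (λ P'm → contradiction P'm ¬P'm))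
  ... | no ¬Pm | yes P'm = pair m (j ∸ suc (k m)) , (begin
    embed (pair m (j ∸ suc (k m)))      ≡⟨ embed-pair m _ ⟩
    pair m (j ∸ suc (k m) + shift m)    ≡⟨ cong (λ s → pair m (j ∸ suc (k m) + s)) (shift-new ¬Pm P'm) ⟩
    pair m (j ∸ suc (k m) + suc (k m))  ≡⟨ cong (pair m) (ℕ.m∸n+n≡m km<j) ⟩
    pair m j                            ∎)
    where
    open ≡-Reasoning
    km<j : k m < j
    km<j = ℕ.≰⇒> λ j≤km → notNew (S'.inBlock P'm j≤km , ¬Pm)

  blockSum-⊴ : BlockSum.lo P? k q ⊴ BlockSum.lo P'? k q
  blockSum-⊴ = embed , record
    { preserve = λ x y x≤y →
        S'.≤-byKeys (key-embed x) (key-embed y) (shiftKey-mono (S.≤⇒≤K x≤y))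
    ; reflect  = λ x y ex≤ey →
        S.≤K⇒≤ (shiftKey-reflect (S'.≤⇒≤-keys (key-embed x) (key-embed y) ex≤ey))
    ; convex   = convex
    }
    where
    convex : ∀ x z y → S'.orderCode ⊢ embed x ≤ y → S'.orderCode ⊢ y ≤ embed z →
             ∃ λ w → embed w ≡ y
    convex _ z y _ y≤ez with unpair y | pair-unpair y
    ... | m , j | refl = embed-surjective m j (λ (b' , ¬Pm) → newBlock-aboveImage b' ¬Pm z y≤ez)

module _ {P P' : Pred ℕ 0ℓ} {P? : Decidable P} {P'? : Decidable P'} {k k' : ℕ → ℕ} {q q' : ℕ → ℚ}
         (D : DenseWithoutMaximum P q) (D' : DenseWithoutMaximum P' q') where

  -- A convex embedding carries the block of n to a maximal finite interval of the same size.
  ⊴⇒widths⊆ : BlockSum.lo P? k q ⊴ BlockSum.lo P'? k' q' →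
              ∀ {n} → P n → ∃ λ n' → P' n' × k n ≡ k' n'
  ⊴⇒widths⊆ (f , E) Pn =
    BlockSum.block⇒width P'? k' q' D'
      (map-innerBlock (BlockSum.isLinearOrderCode P? k q) (BlockSum.isLinearOrderCode P'? k' q') E
        (BlockSum.innerBlock P? k q D Pn))

double : ℕ → ℕ
double zero    = zero
double (suc n) = suc (suc (double n))

zigzag : ℤ → ℕ
zigzag (+ n)    = double n
zigzag -[1+ n ] = suc (double n)

unzigzag : ℕ → ℤ
unzigzag zero          = + 0
unzigzag (suc zero)    = -[1+ 0 ]
unzigzag (suc (suc m)) = away (unzigzag m)
  where
  away : ℤ → ℤ
  away (+ n)    = + suc n
  away -[1+ n ] = -[1+ suc n ]

unzigzag-zigzag : ∀ z → unzigzag (zigzag z) ≡ z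
unzigzag-zigzag (+ n)    = even n
  where
  even : ∀ n → unzigzag (double n) ≡ + n
  even zero    = refl
  even (suc n) rewrite even n = refl
unzigzag-zigzag -[1+ n ] = odd n
  where
  odd : ∀ n → unzigzag (suc (double n)) ≡ -[1+ n ]
  odd zero    = refl
  odd (suc n) rewrite odd n = refl

encode : ℚ → ℕ
encode p = pair (zigzag (ℚ.numerator p)) (ℚ.denominator-1 p)

decode : ℕ → ℚ
decode x = uncurry (λ a d → unzigzag a ℚ./ suc d) (unpair x)

decode-encode : ∀ p → decode (encode p) ≡ p
decode-encode p
  rewrite unpair-pair (zigzag (ℚ.numerator p)) (ℚ.denominator-1 p) | unzigzag-zigzag (ℚ.numerator p)
  = ℚ.↥p/↧p≡p p

Canonical : ℕ → Set
Canonical n = encode (decode n) ≡ n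

canonical-encode : ∀ p → Canonical (encode p)
canonical-encode p = cong encode (decode-encode p)

Encodes : (ℚ → Set) → ℕ → Set
Encodes C n = Canonical n × C (decode n)

encodes? : ∀ {C : ℚ → Set} → Decidable C → Decidable (Encodes C)
encodes? C? n = (encode (decode n) ℕ.≟ n) ×-dec C? (decode n)

encodes-encode : ∀ {C : ℚ → Set} p → C p → Encodes C (encode p)
encodes-encode {C} p Cp = canonical-encode p , subst C (sym (decode-encode p)) Cp

denseWithoutMaximum-encodes : ∀ {C : ℚ → Set} → (∀ {p p'} → p ℚ.≤ p' → C p' → C p) →
                              (∀ {p} → C p → ∃ λ p' → p ℚ.< p' × C p') →
                              DenseWithoutMaximum (Encodes C) decode
denseWithoutMaximum-encodes {C} C-downward C-noMax = record
  { injective = λ (cm , _) (cn , _) eq → trans (sym cm) (trans (cong encode eq) cn)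
  ; dense     = λ _ (_ , Cn) qm<qn → let p , qm<p , p<qn = ℚ.<-dense qm<qn in
      encode p , encodes-encode {C} p (C-downward (ℚ.<⇒≤ p<qn) Cn) , decoded> qm<p , decoded< p<qn
  ; unbounded = λ (_ , Cn) → let p , qn<p , Cp = C-noMax Cn in
      encode p , encodes-encode {C} p Cp , decoded> qn<p
  }
  where
  decoded> : ∀ {p p'} → p ℚ.< p' → p ℚ.< decode (encode p')
  decoded> {p} {p'} = subst (p ℚ.<_) (sym (decode-encode p'))
  decoded< : ∀ {p p'} → p ℚ.< p' → decode (encode p) ℚ.< p'
  decoded< {p} {p'} = subst (ℚ._< p') (sym (decode-encode p))

InCut : ℝ → ℚ → Set
InCut r p = cut r p ≡ true

chain : ℝ → LO
chain r = BlockSum.lo (encodes? (λ p → cut r p Bool.≟ true)) id decode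

chain-denseWithoutMaximum : ∀ r → DenseWithoutMaximum (Encodes (InCut r)) decode
chain-denseWithoutMaximum r = denseWithoutMaximum-encodes (downward r _ _) (noMax r _)

chain-⊴ : ∀ r s → (∀ p → InCut r p → InCut s p) → chain r ⊴ chain s
chain-⊴ r _ r⊆s = blockSum-⊴ _ _ id decode
  (λ (c , p∈r) → c , r⊆s _ p∈r)
  (λ (c , _) (_ , p'∈r) p≤p' → c , downward r _ _ p≤p' p'∈r)

<ℝ⇒⊆ : ∀ r s → r <ℝ s → ∀ p → InCut r p → InCut s p
<ℝ⇒⊆ r s (w , w∉r , w∈s) p p∈r with ℚ.≤-total p w
... | inj₁ p≤w = downward s p w p≤w w∈s
... | inj₂ w≤p = contradiction (trans (sym (downward r w p w≤p p∈r)) w∉r) λ ()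

chain-strict : ∀ r s → r <ℝ s → ¬ chain s ⊴ chain r
chain-strict r s (w , w∉r , w∈s) s⊴r
  with ⊴⇒widths⊆ (chain-denseWithoutMaximum s) (chain-denseWithoutMaximum r) s⊴r
                 (encodes-encode {InCut s} w w∈s)
... | _ , (_ , w∈r) , refl =
  contradiction (trans (sym (subst (InCut r) (decode-encode w) w∈r)) w∉r) λ ()

bitℕ : Bool → ℕ
bitℕ false = 0
bitℕ true  = 1

bitℕ-injective : ∀ {x y} → bitℕ x ≡ bitℕ y → x ≡ y
bitℕ-injective {false} {false} _ = refl
bitℕ-injective {true}  {true}  _ = refl

unitFraction : ℕ → ℚ
unitFraction j = mkℚ (+ 1) j (1-coprimeTo (suc j))

-- Injective in n and in the bit; the block of the code of 1/(j+1) carries the bit a j.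
width : (ℕ → Bool) → ℕ → ℕ
width a n = pair n (bitℕ (a (ℚ.denominator-1 (decode n))))

antichain : (ℕ → Bool) → LO
antichain a = BlockSum.lo (encodes? {λ _ → ⊤} (λ _ → yes tt)) (width a) decode

antichain-denseWithoutMaximum : DenseWithoutMaximum (Encodes (λ _ → ⊤)) decode
antichain-denseWithoutMaximum =
  denseWithoutMaximum-encodes (const id) (λ {p} _ → p ℚ.+ ℚ.1ℚ , p<p+1 p , tt)
  where
  p<p+1 : ∀ p → p ℚ.< p ℚ.+ ℚ.1ℚ
  p<p+1 p = subst (ℚ._< p ℚ.+ ℚ.1ℚ) (ℚ.+-identityʳ p) (ℚ.+-monoʳ-< p (ℚ.positive⁻¹ ℚ.1ℚ))

antichain-⊴⇒≡ : ∀ {a b} → antichain a ⊴ antichain b → ∀ j → a j ≡ b j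
antichain-⊴⇒≡ {a} {b} a⊴b j
  with ⊴⇒widths⊆ antichain-denseWithoutMaximum antichain-denseWithoutMaximum a⊴b
         (encodes-encode {λ _ → ⊤} (unitFraction j) tt)
... | _ , _ , widths≡ with pair-injective widths≡
...   | refl , bits≡ = subst (λ i → a i ≡ b i) denominator≡j (bitℕ-injective bits≡)
  where
  denominator≡j : ℚ.denominator-1 (decode (encode (unitFraction j))) ≡ j
  denominator≡j = cong ℚ.denominator-1 (decode-encode (unitFraction j))

proposition3p5 :
    (Σ (ℝ → LO) λ f →
        (∀ r s → r ≃ℝ s → f r ⊴ f s)
      × (∀ r s → r <ℝ s → (f r ⊴ f s) × ¬ (f s ⊴ f r)))
    ×
    (Σ ((ℕ → Bool) → LO) λ g →
        ∀ a b → ¬ (∀ n → a n ≡ b n) → ¬ (g a ⊴ g b))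
proposition3p5 =
  (chain , (λ r s r≃s → chain-⊴ r s (λ p → trans (sym (r≃s p)))) ,
           (λ r s r<s → chain-⊴ r s (<ℝ⇒⊆ r s r<s) , chain-strict r s r<s)) ,
  (antichain , λ a b a≢b a⊴b → a≢b (antichain-⊴⇒≡ a⊴b))
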